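{- Let $n\ge 1$ and let $i,j,k\in\{0,1,\dots,n\}$, and set $r:=i+j-k$. Then \[ C^k_{i,j}=\sum_{M}\operatorname{wt}(M), \] where the sum runs over all $r$-matchings $M$ of the complete bipartite graph $\mathcal{G}^i_j$ (an empty sum is $0$; the empty matching, when $r=0$, has weight $1$).
   Context: Let $T\subset \mathrm{GL}_{n+1}$ be the diagonal torus acting on $\mathbb{P}^n$, with $H_T^*(\mathrm{pt})=\mathbb{Z}[t_1,\dots,t_{n+1}]$, where $t_i$ is the weight of the $T$-action on the $i$th coordinate line. For $0\le k\le n$ let $X_k=\{x_0=\dots=x_{k-1}=0\}\subset\mathbb{P}^n$ and $\sigma_k=[X_k]_T\in H_T^*(\mathbb{P}^n)$; with $\zeta=c_1^T(\mathcal{O}(1))$ one has $\sigma_k=\prod_{m=1}^k(\zeta+t_m)$. The $\sigma_k$ form an $H_T^*(\mathrm{pt})$-basis, and the structure constants $C^k_{i,j}\in H_T^*(\mathrm{pt})$ are defined by $\sigma_i\sigma_j=\sum_{k=0}^nC^k_{i,j}\sigma_k$. Put $\beta_m:=t_m-t_{m+1}$. The graph $\mathcal{G}^i_j$ is the complete bipartite graph on vertex sets $A=\{a_1,\dots,a_i\}$ and $B=\{b_1,\dots,b_j\}$; an $r$-matching is a set of $r$ pairwise vertex-disjoint edges $a_gb_h$. For an edge $e=a_gb_h$ of a matching $M$, its crossing value is $X(e)=\#\{a_pb_q\in M: p<g,\ q<h\}$, its weight is $\operatorname{wt}(e)=g+h-X(e)-1$, and $\operatorname{wt}(M)=\prod_{e\in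 M}\beta_{\operatorname{wt}(e)}$. -}

module Defs where

open import Algebra.Bundles using (CommutativeRing)
open import Data.Nat using (ℕ; zero; suc; _∸_; _<ᵇ_)
open import Data.Nat as ℕ using ()
open import Data.Nat.Properties using (_≟_)
open import Data.Bool using (Bool; true; false; _∧_)
open import Data.Fin using (Fin; toℕ)
open import Data.Fin.Properties as FinP using ()
open import Data.Maybe using (Maybe; just; nothing)
open import Data.List using (List; []; _∷_; [_]; foldr; map; filter; length; concatMap; upTo; allFin; filterᵇ)
open import Data.List.Relation.Unary.Unique.Propositional using (Unique)
open import Data.List.Relation.Unary.Unique.DecPropositional using (unique?)
open import Data.Product using (_×_; _,_; proj₁; proj₂)
open import Data.Vec using (Vec; []; _∷_)
open import Relation.Binary.PropositionalEquality using (_≡_)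
open import Relation.Nullary.Decidable using (Dec)

-- A = {a_1..a_i} is indexed by Fin i (a_{g} ↔ position g-1),
-- B = {b_1..b_j} by Fin j (b_{h} ↔ h-1).
-- A matching is encoded (bijectively) as a partial injective map
-- A ⇀ B : a vector v of length i with v[g] = just h iff a_{g+1} b_{h+1} ∈ M.

PMap : ℕ → ℕ → Set
PMap i j = Vec (Maybe (Fin j)) i

allPMaps : (i j : ℕ) → List (PMap i j)
allPMaps zero    j = [ [] ]
allPMaps (suc i) j =
  concatMap (λ v → (nothing ∷ v) ∷ map (λ h → just h ∷ v) (allFin j)) (allPMaps i j)

targets : ∀ {i j} → PMap i j → List (Fin j)
targets []             = []
targets (nothing ∷ v)  = targets v
targets (just h ∷ v)   = h ∷ targets v

IsMatching : ∀ {i j} → PMap i j → Set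
IsMatching v = Unique (targets v)

isMatching? : ∀ {i j} (v : PMap i j) → Dec (IsMatching v)
isMatching? {j = j} v = unique? FinP._≟_ (targets v)

matchings : (i j : ℕ) → List (PMap i j)
matchings i j = filter isMatching? (allPMaps i j)

size : ∀ {i j} → PMap i j → ℕ
size v = length (targets v)

-- all r-matchings with r = i + j - k, i.e. matchings M with |M| + k = i + j
-- (if k > i + j there are none)
matchingsFor : (i j k : ℕ) → List (PMap i j)
matchingsFor i j k = filter (λ v → (size v ℕ.+ k) ≟ (i ℕ.+ j)) (matchings i j)

-- edges of a matching as pairs (g , h) of 0-based indices
-- (so the edge is a_{g+1} b_{h+1})
edgesFrom : ∀ {i j} → ℕ → PMap i j → List (ℕ × ℕ)
edgesFrom g []             = []
edgesFrom g (nothing ∷ v)  = edgesFrom (suc g) v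
edgesFrom g (just h ∷ v)   = (g , toℕ h) ∷ edgesFrom (suc g) v

edges : ∀ {i j} → PMap i j → List (ℕ × ℕ)
edges = edgesFrom 0

crossing : List (ℕ × ℕ) → ℕ × ℕ → ℕ
crossing es (g , h) =
  length (filterᵇ (λ e → (proj₁ e <ᵇ g) ∧ (proj₂ e <ᵇ h)) es)

-- wt(e) = g + h - X(e) - 1 in 1-based indices, i.e.
-- (g0 + 1) + (h0 + 1) - X(e) - 1 = g0 + h0 + 1 - X(e) in 0-based ones
edgeWeight : List (ℕ × ℕ) → ℕ × ℕ → ℕ
edgeWeight es (g , h) = suc (g ℕ.+ h) ∸ crossing es (g , h)

-- Ring-valued quantities.  t : ℕ → R with t m the weight t_m
-- (only t 1, …, t (n+1) are relevant; t 0 is unused).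

module _ {c ℓ} (R : CommutativeRing c ℓ) where
  open CommutativeRing R

  sumR : List Carrier → Carrier
  sumR = foldr _+_ 0#

  prodR : List Carrier → Carrier
  prodR = foldr _*_ 1#

  σ : (t : ℕ → Carrier) (ζ : Carrier) → ℕ → Carrier
  σ t ζ zero    = 1#
  σ t ζ (suc k) = σ t ζ k * (ζ + t (suc k))

  β : (t : ℕ → Carrier) → ℕ → Carrier
  β t m = t m - t (suc m)

  wtM : (t : ℕ → Carrier) → ∀ {i j} → PMap i j → Carrier
  wtM t v = prodR (map (λ e → β t (edgeWeight (edges v) e)) (edges v))

  matchingSum : (t : ℕ → Carrier) → (i j k : ℕ) → Carrier
  matchingSum t i j k = sumR (map (wtM t) (matchingsFor i j k))

{-# OPTIONS --safe #-}
-- Read a matching row by row, a₁ first, keeping track of the B-vertices already used.  When the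
-- edge a_{g+1} b_{h+1} is added while r of b₁ … b_h are still unused, the earlier edges crossing
-- it are exactly those ending at the h − r used ones, so its weight is g + 1 + r: it only depends
-- on the rank of b_{h+1} among the unused vertices.  Hence the sum, over injective maps of i
-- further rows into F unused columns, of ∏ β · σ_{g+i+F−|M|} equals σ_{g+i} ∏_{m=g+1}^{g+F} (ζ + t_m):
-- the next row is either skipped or matched to the unused vertex of rank r with factor β_{g+1+r},
-- and ∑_{r<F} β_{g+1+r} = t_{g+1} − t_{g+1+F} telescopes into the recursion of that product.
-- For g = 0 and F = j this is the polynomial identity σ_i σ_j = ∑_M wt(M) σ_{i+j−|M|}, and
-- σ_k = 0 for k > n because σ_{n+1} divides σ_k.
module Submission where

open import Defs
open import Algebra.Bundles using (CommutativeRing)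
open import Data.Nat using (ℕ; suc; _≤_)
open import Data.Nat as ℕ using (zero)
import Data.Nat.Properties as ℕₚ
open import Data.List using (map; upTo)

import Algebra.Solver.Ring as RingSolver
open import Algebra.Solver.Ring.AlmostCommutativeRing using (fromCommutativeRing; -raw-almostCommutative⟶)
open import Data.Bool using (Bool; true; false; T; if_then_else_; _∧_)
open import Data.Bool.Properties using (T-∧)
open import Data.Fin as Fin using (Fin; toℕ)
open import Data.List using (List; []; _∷_; _++_; [_]; length; filter; filterᵇ; concatMap; allFin)
open import Data.List.Properties using (upTo-∷ʳ; map-∘; map-tabulate; filter-++; filter-none; length-++; ++-assoc; ++-identityʳ)
open import Data.List.Relation.Unary.All as All using (All; []; _∷_)
open import Data.List.Relation.Unary.All.Properties using (++⁺)
open import Data.List.Relation.Unary.AllPairs using ([]; _∷_)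
open import Data.List.Relation.Unary.Unique.Propositional using (Unique)
open import Data.Maybe using (just; nothing)
open import Data.Product using (_×_; _,_; proj₁; proj₂)
open import Data.Vec using (Vec; []; _∷_; lookup; replicate; _[_]≔_)
open import Data.Vec.Properties using (lookup∘update; lookup∘update′; lookup-replicate)
open import Function using (id; _∘_; Equivalence; mk⇔)
open import Relation.Binary.Definitions using (Tri; tri<; tri≈; tri>)
open import Relation.Binary.PropositionalEquality as ≡ using (_≡_)
open import Relation.Nullary using (¬_; Dec; does; yes; no; contradiction)
open import Relation.Nullary.Decidable using (T?; does-⇔; dec-true; dec-false)

-- ℕ arithmetic is opened only inside this module; in the next one _+_ and _*_ are the ring operations.
module _ where
  open import Data.Nat using (_+_; _∸_; _<_; _<ᵇ_; z≤n; s≤s)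
  open import Data.Nat.Properties
  open import Relation.Binary.PropositionalEquality hiding ([_])
  open ≡-Reasoning
  open import Data.Nat.Solver using (module +-*-Solver)
  open +-*-Solver using (solve; con; _:+_; _:=_)

  -- A state S : Vec Bool j marks with true the B-vertices matched by the rows read so far.
  free : ∀ {j} → Vec Bool j → ℕ
  free []      = 0
  free (b ∷ S) = if b then free S else suc (free S)

  usedBelow : ∀ {j} → ℕ → Vec Bool j → ℕ
  usedBelow zero    S       = 0
  usedBelow (suc x) []      = 0
  usedBelow (suc x) (b ∷ S) = if b then suc (usedBelow x S) else usedBelow x S

  freeBelow : ∀ {j} → Fin j → Vec Bool j → ℕ
  freeBelow Fin.zero    S       = 0
  freeBelow (Fin.suc h) (b ∷ S) = if b then freeBelow h S else suc (freeBelow h S)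

  usedBelow+freeBelow : ∀ {j} (h : Fin j) (S : Vec Bool j) → usedBelow (toℕ h) S + freeBelow h S ≡ toℕ h
  usedBelow+freeBelow Fin.zero    S           = refl
  usedBelow+freeBelow (Fin.suc h) (true ∷ S)  = cong suc (usedBelow+freeBelow h S)
  usedBelow+freeBelow (Fin.suc h) (false ∷ S) = trans (+-suc _ _) (cong suc (usedBelow+freeBelow h S))

  free-mark : ∀ {j} (h : Fin j) (S : Vec Bool j) → lookup S h ≡ false → free S ≡ suc (free (S [ h ]≔ true))
  free-mark Fin.zero    (false ∷ S) _      = refl
  free-mark (Fin.suc h) (true ∷ S)  h-free = free-mark h S h-free
  free-mark (Fin.suc h) (false ∷ S) h-free = cong suc (free-mark h S h-free)

  usedBelow-mark : ∀ {j} (h : Fin j) (S : Vec Bool j) → lookup S h ≡ false → ∀ x →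
    usedBelow x (S [ h ]≔ true) ≡ usedBelow x S + (if toℕ h <ᵇ x then 1 else 0)
  usedBelow-mark h           S           _      zero    = refl
  usedBelow-mark Fin.zero    (false ∷ S) _      (suc x) = +-comm 1 _
  usedBelow-mark (Fin.suc h) (true ∷ S)  h-free (suc x) = cong suc (usedBelow-mark h S h-free x)
  usedBelow-mark (Fin.suc h) (false ∷ S) h-free (suc x) = usedBelow-mark h S h-free x

  free-replicate : ∀ j → free (replicate j false) ≡ j
  free-replicate zero    = refl
  free-replicate (suc j) = cong suc (free-replicate j)

  usedBelow-replicate : ∀ j x → usedBelow x (replicate j false) ≡ 0
  usedBelow-replicate j       zero    = refl
  usedBelow-replicate zero    (suc x) = refl
  usedBelow-replicate (suc j) (suc x) = usedBelow-replicate j x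

  fits : ∀ {i j} → Vec Bool j → PMap i j → Bool
  fits S []            = true
  fits S (nothing ∷ v) = fits S v
  fits S (just h ∷ v)  = if lookup S h then false else fits (S [ h ]≔ true) v

  unmarked-after-mark : ∀ {j} (S : Vec Bool j) h {x} → lookup (S [ h ]≔ true) x ≡ false → h ≢ x × lookup S x ≡ false
  unmarked-after-mark S h {x} x-free with h Fin.≟ x
  ... | yes refl = contradiction (trans (sym (lookup∘update h S true)) x-free) λ ()
  ... | no h≢x   = h≢x , trans (sym (lookup∘update′ (h≢x ∘ sym) S true)) x-free

  fits-sound : ∀ {i j} (S : Vec Bool j) (v : PMap i j) → T (fits S v) →
    Unique (targets v) × All (λ x → lookup S x ≡ false) (targets v)
  fits-sound S []            _   = [] , []
  fits-sound S (nothing ∷ v) fit = fits-sound S v fit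
  fits-sound S (just h ∷ v)  fit with lookup S h in h-free
  ... | false =
    All.map (proj₁ ∘ unmarked-after-mark S h) rest-free ∷ rest-unique ,
    h-free ∷ All.map (proj₂ ∘ unmarked-after-mark S h) rest-free
    where
    rest-unique = proj₁ (fits-sound (S [ h ]≔ true) v fit)
    rest-free   = proj₂ (fits-sound (S [ h ]≔ true) v fit)

  fits-complete : ∀ {i j} (S : Vec Bool j) (v : PMap i j) →
    Unique (targets v) → All (λ x → lookup S x ≡ false) (targets v) → T (fits S v)
  fits-complete S []            _             _                    = _
  fits-complete S (nothing ∷ v) unique        unmarked             = fits-complete S v unique unmarked
  fits-complete S (just h ∷ v)  (h∉ ∷ unique) (h-free ∷ rest-free) rewrite h-free =
    fits-complete (S [ h ]≔ true) v unique
      (All.zipWith (λ (h≢x , x-free) → trans (lookup∘update′ (h≢x ∘ sym) S true) x-free) (h∉ , rest-free))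

  isMatching?≡fits : ∀ {i j} (v : PMap i j) → does (isMatching? v) ≡ fits (replicate j false) v
  isMatching?≡fits v = does-⇔
    (mk⇔ (λ unique → fits-complete _ v unique (All.universal (λ x → lookup-replicate x false) _))
         (proj₁ ∘ fits-sound _ v))
    (isMatching? v) (T? _)

  size≤ : ∀ {i j} (v : PMap i j) → size v ≤ i
  size≤ []            = z≤n
  size≤ (nothing ∷ v) = m≤n⇒m≤1+n (size≤ v)
  size≤ (just h ∷ v)  = s≤s (size≤ v)

  columnsBelow : ℕ → List (ℕ × ℕ) → ℕ
  columnsBelow x es = length (filterᵇ (λ e → proj₂ e <ᵇ x) es)

  columnsBelow-∷ʳ : ∀ x es g c → columnsBelow x (es ++ [ (g , c) ]) ≡ columnsBelow x es + (if c <ᵇ x then 1 else 0)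
  columnsBelow-∷ʳ x es g c = begin
    length (filterᵇ p (es ++ [ (g , c) ]))          ≡⟨ cong length (filter-++ (T? ∘ p) es _) ⟩
    length (filterᵇ p es ++ filterᵇ p [ (g , c) ])  ≡⟨ length-++ (filterᵇ p es) ⟩
    columnsBelow x es + length (filterᵇ p [ (g , c) ]) ≡⟨ cong (columnsBelow x es +_) singleton ⟩
    columnsBelow x es + (if c <ᵇ x then 1 else 0)    ∎
    where
    p : ℕ × ℕ → Bool
    p e = proj₂ e <ᵇ x
    singleton : length (filterᵇ p [ (g , c) ]) ≡ (if c <ᵇ x then 1 else 0)
    singleton with c <ᵇ x
    ... | true  = refl
    ... | false = refl

  filterᵇ-∧ˡ : ∀ {A : Set} (p q : A → Bool) {xs} → All (T ∘ p) xs →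
    filterᵇ (λ x → p x ∧ q x) xs ≡ filterᵇ q xs
  filterᵇ-∧ˡ p q [] = refl
  filterᵇ-∧ˡ p q {x ∷ _} (px ∷ pxs) with p x | px | q x
  ... | true | _ | true  = cong (x ∷_) (filterᵇ-∧ˡ p q pxs)
  ... | true | _ | false = filterᵇ-∧ˡ p q pxs

  crossing-split : ∀ {g} h pre rest → All (λ e → proj₁ e < g) pre → All (λ e → g ≤ proj₁ e) rest →
    crossing (pre ++ rest) (g , h) ≡ columnsBelow h pre
  crossing-split {g} h pre rest pre<g g≤rest = begin
    length (filterᵇ q (pre ++ rest))
      ≡⟨ cong length (filter-++ (T? ∘ q) pre rest) ⟩
    length (filterᵇ q pre ++ filterᵇ q rest)
      ≡⟨ cong (λ es → length (filterᵇ q pre ++ es)) (filter-none (T? ∘ q) (All.map not-earlier g≤rest)) ⟩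
    length (filterᵇ q pre ++ [])
      ≡⟨ cong length (++-identityʳ (filterᵇ q pre)) ⟩
    length (filterᵇ q pre)
      ≡⟨ cong length (filterᵇ-∧ˡ (λ e → proj₁ e <ᵇ g) _ (All.map <⇒<ᵇ pre<g)) ⟩
    columnsBelow h pre
      ∎
    where
    q : ℕ × ℕ → Bool
    q e = (proj₁ e <ᵇ g) ∧ (proj₂ e <ᵇ h)
    not-earlier : ∀ {e} → g ≤ proj₁ e → ¬ T (q e)
    not-earlier {e} g≤e qe = <⇒≱ (<ᵇ⇒< _ _ (proj₁ (Equivalence.to T-∧ qe))) g≤e

  edgesFrom-rows : ∀ {i j} g (v : PMap i j) → All (λ e → g ≤ proj₁ e) (edgesFrom g v)
  edgesFrom-rows g []            = []
  edgesFrom-rows g (nothing ∷ v) = All.map <⇒≤ (edgesFrom-rows (suc g) v)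
  edgesFrom-rows g (just h ∷ v)  = ≤-refl ∷ All.map <⇒≤ (edgesFrom-rows (suc g) v)

  rankWeights : ∀ {i j} → ℕ → Vec Bool j → PMap i j → List ℕ
  rankWeights g S []            = []
  rankWeights g S (nothing ∷ v) = rankWeights (suc g) S v
  rankWeights g S (just h ∷ v)  = suc (g + freeBelow h S) ∷ rankWeights (suc g) (S [ h ]≔ true) v

  edgeWeight-freeRank : ∀ {j g} (h : Fin j) (S : Vec Bool j) pre rest →
    All (λ e → proj₁ e < g) pre → All (λ e → g ≤ proj₁ e) rest → (∀ x → columnsBelow x pre ≡ usedBelow x S) →
    edgeWeight (pre ++ rest) (g , toℕ h) ≡ suc (g + freeBelow h S)
  edgeWeight-freeRank {g = g} h S pre rest pre<g g≤rest columns = begin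
    suc (g + toℕ h) ∸ crossing (pre ++ rest) (g , toℕ h)
      ≡⟨ cong (suc (g + toℕ h) ∸_) (trans (crossing-split (toℕ h) pre rest pre<g g≤rest) (columns (toℕ h))) ⟩
    suc (g + toℕ h) ∸ u
      ≡⟨ cong (λ m → suc (g + m) ∸ u) (sym (usedBelow+freeBelow h S)) ⟩
    suc (g + (u + f)) ∸ u
      ≡⟨ cong (_∸ u) (solve 3 (λ g u f → con 1 :+ (g :+ (u :+ f)) := u :+ (con 1 :+ (g :+ f))) refl g u f) ⟩
    u + suc (g + f) ∸ u
      ≡⟨ m+n∸m≡n u _ ⟩
    suc (g + f) ∎
    where
    u = usedBelow (toℕ h) S
    f = freeBelow h S

  -- pre holds the edges of the rows already read; the counting hypothesis says that S marks exactly their columns.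
  edgeWeights≡rankWeights : ∀ {i j} g (S : Vec Bool j) pre (v : PMap i j) →
    All (λ e → proj₁ e < g) pre → (∀ x → columnsBelow x pre ≡ usedBelow x S) → T (fits S v) →
    map (edgeWeight (pre ++ edgesFrom g v)) (edgesFrom g v) ≡ rankWeights g S v
  edgeWeights≡rankWeights g S pre []            _     _       _   = refl
  edgeWeights≡rankWeights g S pre (nothing ∷ v) pre<g columns fit =
    edgeWeights≡rankWeights (suc g) S pre v (All.map m<n⇒m<1+n pre<g) columns fit
  edgeWeights≡rankWeights g S pre (just h ∷ v)  pre<g columns fit with lookup S h in h-free
  ... | false = cong₂ _∷_
    (edgeWeight-freeRank h S pre _ pre<g (edgesFrom-rows g (just h ∷ v)) columns)
    (trans (cong (λ es → map (edgeWeight es) rest) (sym (++-assoc pre [ (g , toℕ h) ] rest)))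
           (edgeWeights≡rankWeights (suc g) (S [ h ]≔ true) pre′ v pre′<1+g columns′ fit))
    where
    rest = edgesFrom (suc g) v
    pre′ = pre ++ [ (g , toℕ h) ]
    pre′<1+g : All (λ e → proj₁ e < suc g) pre′
    pre′<1+g = ++⁺ (All.map m<n⇒m<1+n pre<g) (n<1+n g ∷ [])
    columns′ : ∀ x → columnsBelow x pre′ ≡ usedBelow x (S [ h ]≔ true)
    columns′ x = begin
      columnsBelow x pre′                                     ≡⟨ columnsBelow-∷ʳ x pre g (toℕ h) ⟩
      columnsBelow x pre + (if toℕ h <ᵇ x then 1 else 0)      ≡⟨ cong (_+ _) (columns x) ⟩
      usedBelow x S + (if toℕ h <ᵇ x then 1 else 0)           ≡⟨ usedBelow-mark h S h-free x ⟨
      usedBelow x (S [ h ]≔ true)                             ∎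

module _ {c ℓ} (R : CommutativeRing c ℓ) where
  open CommutativeRing R renaming (refl to ≈-refl)
  -- Equality of coefficients is not decidable in R, so the solver cannot cancel x - x; such
  -- cancellations are done by hand with -‿inverseʳ.
  open RingSolver rawRing (fromCommutativeRing R) (-raw-almostCommutative⟶ _) (λ _ _ → nothing)
    using (solve; _:+_; _:*_; _:-_; _:=_)
  open import Relation.Binary.Reasoning.Setoid setoid

  ∑ : ∀ {A : Set} → List A → (A → Carrier) → Carrier
  ∑ xs f = sumR R (map f xs)

  syntax ∑ xs (λ x → f) = ∑[ x ∈ xs ] f

  ∑-cong : ∀ {A : Set} (xs : List A) {f g : A → Carrier} → (∀ x → f x ≈ g x) → ∑ xs f ≈ ∑ xs g
  ∑-cong []       f≈g = ≈-refl
  ∑-cong (x ∷ xs) f≈g = +-cong (f≈g x) (∑-cong xs f≈g)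

  ∑-zero : ∀ {A : Set} (xs : List A) {f : A → Carrier} → (∀ x → f x ≈ 0#) → ∑ xs f ≈ 0#
  ∑-zero []       f≈0 = ≈-refl
  ∑-zero (x ∷ xs) f≈0 = trans (+-cong (f≈0 x) (∑-zero xs f≈0)) (+-identityˡ 0#)

  ∑-++ : ∀ {A : Set} (xs ys : List A) (f : A → Carrier) → ∑ (xs ++ ys) f ≈ ∑ xs f + ∑ ys f
  ∑-++ []       ys f = sym (+-identityˡ _)
  ∑-++ (x ∷ xs) ys f = trans (+-congˡ (∑-++ xs ys f)) (sym (+-assoc _ _ _))

  ∑-concatMap : ∀ {A B : Set} (g : A → List B) (xs : List A) (f : B → Carrier) →
    ∑ (concatMap g xs) f ≈ ∑[ x ∈ xs ] ∑ (g x) f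
  ∑-concatMap g []       f = ≈-refl
  ∑-concatMap g (x ∷ xs) f = trans (∑-++ (g x) (concatMap g xs) f) (+-congˡ (∑-concatMap g xs f))

  ∑-+ : ∀ {A : Set} (xs : List A) (f g : A → Carrier) → ∑[ x ∈ xs ] (f x + g x) ≈ ∑ xs f + ∑ xs g
  ∑-+ []       f g = sym (+-identityˡ 0#)
  ∑-+ (x ∷ xs) f g = trans (+-congˡ (∑-+ xs f g)) (interchange (f x) (g x) _ _)
    where
    interchange : ∀ a b c d → (a + b) + (c + d) ≈ (a + c) + (b + d)
    interchange = solve 4 (λ a b c d → (a :+ b) :+ (c :+ d) := (a :+ c) :+ (b :+ d)) ≈-refl

  ∑-*ˡ : ∀ {A : Set} (xs : List A) a (f : A → Carrier) → ∑[ x ∈ xs ] (a * f x) ≈ a * ∑ xs f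
  ∑-*ˡ []       a f = sym (zeroʳ a)
  ∑-*ˡ (x ∷ xs) a f = trans (+-congˡ (∑-*ˡ xs a f)) (sym (distribˡ a (f x) _))

  ∑-*ʳ : ∀ {A : Set} (xs : List A) a (f : A → Carrier) → ∑[ x ∈ xs ] (f x * a) ≈ ∑ xs f * a
  ∑-*ʳ []       a f = sym (zeroˡ a)
  ∑-*ʳ (x ∷ xs) a f = trans (+-congˡ (∑-*ʳ xs a f)) (sym (distribʳ a (f x) _))

  ∑-comm : ∀ {A B : Set} (xs : List A) (ys : List B) (f : A → B → Carrier) →
    ∑[ x ∈ xs ] ∑[ y ∈ ys ] f x y ≈ ∑[ y ∈ ys ] ∑[ x ∈ xs ] f x y
  ∑-comm []       ys f = sym (∑-zero ys (λ _ → ≈-refl))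
  ∑-comm (x ∷ xs) ys f = trans (+-congˡ (∑-comm xs ys f)) (sym (∑-+ ys (f x) _))

  ∑-filter : ∀ {A : Set} {P : A → Set} (P? : ∀ x → Dec (P x)) (xs : List A) (f : A → Carrier) →
    ∑ (filter P? xs) f ≈ ∑[ x ∈ xs ] (if does (P? x) then f x else 0#)
  ∑-filter P? []       f = ≈-refl
  ∑-filter P? (x ∷ xs) f with does (P? x)
  ... | true  = +-congˡ (∑-filter P? xs f)
  ... | false = trans (∑-filter P? xs f) (sym (+-identityˡ _))

  if-cong : ∀ b {x y} → (T b → x ≈ y) → (if b then x else 0#) ≈ (if b then y else 0#)
  if-cong true  x≈y = x≈y _
  if-cong false _   = ≈-refl

  if-*ˡ : ∀ b a x → (if b then a * x else 0#) ≈ a * (if b then x else 0#)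
  if-*ˡ true  a x = ≈-refl
  if-*ˡ false a x = sym (zeroʳ a)

  if-*ʳ : ∀ b a x → (if b then x else 0#) * a ≈ (if b then x * a else 0#)
  if-*ʳ true  a x = ≈-refl
  if-*ʳ false a x = zeroˡ a

  x-y+[y-z]≈x-z : ∀ x y z → (x - y) + (y - z) ≈ x - z
  x-y+[y-z]≈x-z x y z = begin
    (x - y) + (y - z)  ≈⟨ rearrange x y (- y) (- z) ⟩
    (x - z) + (y - y)  ≈⟨ +-congˡ (-‿inverseʳ y) ⟩
    (x - z) + 0#       ≈⟨ +-identityʳ _ ⟩
    x - z              ∎
    where
    rearrange : ∀ x y ȳ z̄ → (x + ȳ) + (y + z̄) ≈ (x + z̄) + (y + ȳ)
    rearrange = solve 4 (λ x y ȳ z̄ → (x :+ ȳ) :+ (y :+ z̄) := (x :+ z̄) :+ (y :+ ȳ)) ≈-refl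

  ∑-allFin-suc : ∀ {j} (f : Fin (suc j) → Carrier) → ∑ (allFin (suc j)) f ≡ f Fin.zero + ∑[ h ∈ allFin j ] f (Fin.suc h)
  ∑-allFin-suc f = ≡.cong (λ xs → f Fin.zero + sumR R xs)
    (≡.trans (map-tabulate Fin.suc f) (≡.sym (map-tabulate id (f ∘ Fin.suc))))

  ∑-allPMaps-suc : ∀ {i j} (f : PMap (suc i) j → Carrier) →
    ∑ (allPMaps (suc i) j) f ≈ ∑[ v ∈ allPMaps i j ] (f (nothing ∷ v) + ∑[ h ∈ allFin j ] f (just h ∷ v))
  ∑-allPMaps-suc {i} {j} f = trans (∑-concatMap _ (allPMaps i j) f)
    (∑-cong (allPMaps i j) (λ v → +-congˡ (reflexive (≡.cong (sumR R) (≡.sym (map-∘ (allFin j)))))))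

  ∑-upTo-δ : ∀ N m (f : ℕ → Carrier) →
    ∑[ k ∈ upTo N ] (if does (k ℕ.≟ m) then f k else 0#) ≈ (if does (m ℕ.<? N) then f m else 0#)
  ∑-upTo-δ zero    m f = ≈-refl
  ∑-upTo-δ (suc N) m f = begin
    ∑ (upTo (suc N)) δf                              ≡⟨ ≡.cong (λ ks → ∑ ks δf) (upTo-∷ʳ N) ⟨
    ∑ (upTo N ++ [ N ]) δf                           ≈⟨ ∑-++ (upTo N) [ N ] δf ⟩
    ∑ (upTo N) δf + (δf N + 0#)                      ≈⟨ +-cong (∑-upTo-δ N m f) (+-identityʳ _) ⟩
    (if does (m ℕ.<? N) then f m else 0#) + δf N     ≈⟨ last (ℕₚ.<-cmp m N) ⟩
    (if does (m ℕ.<? suc N) then f m else 0#)        ∎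
    where
    δf : ℕ → Carrier
    δf k = if does (k ℕ.≟ m) then f k else 0#
    last : Tri (m ℕ.< N) (m ≡ N) (N ℕ.< m) →
      (if does (m ℕ.<? N) then f m else 0#) + δf N ≈ (if does (m ℕ.<? suc N) then f m else 0#)
    last (tri< m<N m≢N _)
      rewrite dec-true (m ℕ.<? N) m<N | dec-false (N ℕ.≟ m) (m≢N ∘ ≡.sym) | dec-true (m ℕ.<? suc N) (ℕₚ.m<n⇒m<1+n m<N)
      = +-identityʳ _
    last (tri≈ _ ≡.refl _)
      rewrite dec-false (m ℕ.<? m) (ℕₚ.n≮n m) | dec-true (m ℕ.≟ m) ≡.refl | dec-true (m ℕ.<? suc m) (ℕₚ.n<1+n m)
      = +-identityˡ _
    last (tri> _ m≢N N<m)
      rewrite dec-false (m ℕ.<? N) (ℕₚ.<⇒≯ N<m) | dec-false (N ℕ.≟ m) (m≢N ∘ ≡.sym)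
            | dec-false (m ℕ.<? suc N) (ℕₚ.<⇒≱ N<m ∘ ℕₚ.≤-pred)
      = +-identityˡ _

  -- The row-by-row expansion of σ_i σ_j

  module _ (t : ℕ → Carrier) (ζ : Carrier) where

    σ′ : ℕ → Carrier
    σ′ = σ R t ζ

    β′ : ℕ → Carrier
    β′ = β R t

    segment : ℕ → ℕ → Carrier
    segment a zero    = 1#
    segment a (suc u) = (ζ + t (suc a)) * segment (suc a) u

    σ*segment : ∀ a u → σ′ a * segment a u ≈ σ′ (a ℕ.+ u)
    σ*segment a zero    = trans (*-identityʳ _) (reflexive (≡.cong σ′ (≡.sym (ℕₚ.+-identityʳ a))))
    σ*segment a (suc u) = begin
      σ′ a * ((ζ + t (suc a)) * segment (suc a) u) ≈⟨ *-assoc _ _ _ ⟨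
      σ′ (suc a) * segment (suc a) u                ≈⟨ σ*segment (suc a) u ⟩
      σ′ (suc a ℕ.+ u)                              ≡⟨ ≡.cong σ′ (ℕₚ.+-suc a u) ⟨
      σ′ (a ℕ.+ suc u)                              ∎

    segment-suc : ∀ a u → segment a (suc u) ≈ segment a u * (ζ + t (a ℕ.+ suc u))
    segment-suc a zero    =
      trans (*-identityʳ _) (trans (reflexive (≡.cong (λ m → ζ + t m) (ℕₚ.+-comm 1 a))) (sym (*-identityˡ _)))
    segment-suc a (suc u) = begin
      (ζ + t (suc a)) * segment (suc a) (suc u)
        ≈⟨ *-congˡ (segment-suc (suc a) u) ⟩
      (ζ + t (suc a)) * (segment (suc a) u * (ζ + t (suc a ℕ.+ suc u)))
        ≈⟨ *-assoc _ _ _ ⟨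
      segment a (suc u) * (ζ + t (suc a ℕ.+ suc u))
        ≡⟨ ≡.cong (λ m → segment a (suc u) * (ζ + t m)) (ℕₚ.+-suc a (suc u)) ⟨
      segment a (suc u) * (ζ + t (a ℕ.+ suc (suc u)))
        ∎

    segment-step : ∀ g F → segment (suc g) F + (t (suc g) - t (suc g ℕ.+ F)) * segment (suc g) (ℕ.pred F) ≈ segment g F
    segment-step g zero = begin
      1# + (t (suc g) - t (suc g ℕ.+ 0)) * 1# ≡⟨ ≡.cong (λ m → 1# + (t (suc g) - t m) * 1#) (ℕₚ.+-identityʳ (suc g)) ⟩
      1# + (t (suc g) - t (suc g)) * 1#       ≈⟨ +-congˡ (trans (*-congʳ (-‿inverseʳ _)) (zeroˡ 1#)) ⟩
      1# + 0#                                 ≈⟨ +-identityʳ 1# ⟩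
      1#                                      ∎
    segment-step g (suc F) = begin
      segment (suc g) (suc F) + (d - e) * q ≈⟨ +-congʳ (segment-suc (suc g) F) ⟩
      q * (ζ + e) + (d - e) * q              ≈⟨ rearrange q ζ d e (- e) ⟩
      (ζ + d) * q + (e - e) * q              ≈⟨ +-congˡ (trans (*-congʳ (-‿inverseʳ e)) (zeroˡ q)) ⟩
      (ζ + d) * q + 0#                       ≈⟨ +-identityʳ _ ⟩
      (ζ + d) * q                            ∎
      where
      q = segment (suc g) F
      d = t (suc g)
      e = t (suc g ℕ.+ suc F)
      rearrange : ∀ q z d e ē → q * (z + e) + (d + ē) * q ≈ (z + d) * q + (e + ē) * q
      rearrange = solve 5 (λ q z d e ē → q :* (z :+ e) :+ (d :+ ē) :* q := (z :+ d) :* q :+ (e :+ ē) :* q) ≈-refl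

    σ-vanishes : ∀ n → σ′ (suc n) ≈ 0# → ∀ {m} → suc n ≤ m → σ′ m ≈ 0#
    σ-vanishes n σ₁₊ₙ≈0 {m} n<m = begin
      σ′ m                                    ≡⟨ ≡.cong σ′ (ℕₚ.m+[n∸m]≡n n<m) ⟨
      σ′ (suc n ℕ.+ (m ℕ.∸ suc n))            ≈⟨ σ*segment (suc n) _ ⟨
      σ′ (suc n) * segment (suc n) (m ℕ.∸ suc n) ≈⟨ *-congʳ σ₁₊ₙ≈0 ⟩
      0# * segment (suc n) (m ℕ.∸ suc n)      ≈⟨ zeroˡ _ ⟩
      0#                                      ∎

    rankβ : ∀ {j} → ℕ → Vec Bool j → Fin j → Carrier
    rankβ c S h = if lookup S h then 0# else β′ (c ℕ.+ freeBelow h S)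

    ∑-rankβ : ∀ {j} c (S : Vec Bool j) → ∑ (allFin j) (rankβ c S) ≈ t c - t (c ℕ.+ free S)
    ∑-rankβ c []          = sym (trans (reflexive (≡.cong (λ m → t c - t m) (ℕₚ.+-identityʳ c))) (-‿inverseʳ (t c)))
    ∑-rankβ c (true ∷ S)  = trans (reflexive (∑-allFin-suc (rankβ c (true ∷ S)))) (trans (+-identityˡ _) (∑-rankβ c S))
    ∑-rankβ c (false ∷ S) = begin
      ∑ (allFin _) (rankβ c (false ∷ S))
        ≡⟨ ∑-allFin-suc (rankβ c (false ∷ S)) ⟩
      β′ (c ℕ.+ 0) + ∑[ h ∈ allFin _ ] rankβ c (false ∷ S) (Fin.suc h)
        ≈⟨ +-cong (reflexive (≡.cong β′ (ℕₚ.+-identityʳ c)))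
                  (∑-cong (allFin _) (λ h → reflexive (≡.cong (λ m → if lookup S h then 0# else β′ m) (ℕₚ.+-suc c _)))) ⟩
      β′ c + ∑ (allFin _) (rankβ (suc c) S)
        ≈⟨ +-congˡ (∑-rankβ (suc c) S) ⟩
      (t c - t (suc c)) + (t (suc c) - t (suc c ℕ.+ free S))
        ≈⟨ x-y+[y-z]≈x-z _ _ _ ⟩
      t c - t (suc c ℕ.+ free S)
        ≡⟨ ≡.cong (λ m → t c - t m) (ℕₚ.+-suc c _) ⟨
      t c - t (c ℕ.+ suc (free S))
        ∎

    weightFrom : ∀ {i j} → ℕ → Vec Bool j → PMap i j → Carrier
    weightFrom g S []            = σ′ (g ℕ.+ free S)
    weightFrom g S (nothing ∷ v) = weightFrom (suc g) S v
    weightFrom g S (just h ∷ v)  = β′ (suc (g ℕ.+ freeBelow h S)) * weightFrom (suc g) (S [ h ]≔ true) v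

    weightSum : ∀ {j} → ℕ → ℕ → Vec Bool j → Carrier
    weightSum {j} i g S = ∑[ v ∈ allPMaps i j ] (if fits S v then weightFrom g S v else 0#)

    weightSum-suc : ∀ {j} i g (S : Vec Bool j) →
      weightSum (suc i) g S ≈ weightSum i (suc g) S
        + ∑[ h ∈ allFin j ] (if lookup S h then 0# else β′ (suc (g ℕ.+ freeBelow h S)) * weightSum i (suc g) (S [ h ]≔ true))
    weightSum-suc {j} i g S = begin
      weightSum (suc i) g S
        ≈⟨ ∑-allPMaps-suc {i} (λ v → if fits S v then weightFrom g S v else 0#) ⟩
      ∑[ v ∈ L ] (unmatched v + ∑[ h ∈ allFin j ] matched h v)
        ≈⟨ ∑-+ L _ _ ⟩
      weightSum i (suc g) S + ∑[ v ∈ L ] ∑[ h ∈ allFin j ] matched h v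
        ≈⟨ +-congˡ (trans (∑-comm L (allFin j) _) (∑-cong (allFin j) ∑-matched)) ⟩
      weightSum i (suc g) S
        + ∑[ h ∈ allFin j ] (if lookup S h then 0# else β′ (suc (g ℕ.+ freeBelow h S)) * weightSum i (suc g) (S [ h ]≔ true))
        ∎
      where
      L = allPMaps i j
      unmatched : PMap i j → Carrier
      unmatched v = if fits S (nothing ∷ v) then weightFrom g S (nothing ∷ v) else 0#
      matched : Fin j → PMap i j → Carrier
      matched h v = if fits S (just h ∷ v) then weightFrom g S (just h ∷ v) else 0#
      ∑-matched : ∀ h → ∑[ v ∈ L ] matched h v
        ≈ (if lookup S h then 0# else β′ (suc (g ℕ.+ freeBelow h S)) * weightSum i (suc g) (S [ h ]≔ true))
      ∑-matched h with lookup S h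
      ... | true  = ∑-zero L (λ _ → ≈-refl)
      ... | false = trans (∑-cong L (λ v → if-*ˡ (fits (S [ h ]≔ true) v) _ _)) (∑-*ˡ L _ _)

    weightSum≈σ*segment : ∀ {j} i g (S : Vec Bool j) → weightSum i g S ≈ σ′ (g ℕ.+ i) * segment g (free S)
    weightSum≈σ*segment zero g S = begin
      σ′ (g ℕ.+ free S) + 0#             ≈⟨ +-identityʳ _ ⟩
      σ′ (g ℕ.+ free S)                  ≈⟨ σ*segment g (free S) ⟨
      σ′ g * segment g (free S)          ≡⟨ ≡.cong (λ m → σ′ m * segment g (free S)) (ℕₚ.+-identityʳ g) ⟨
      σ′ (g ℕ.+ 0) * segment g (free S)  ∎
    weightSum≈σ*segment {j} (suc i) g S = begin
      weightSum (suc i) g S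
        ≈⟨ weightSum-suc i g S ⟩
      weightSum i (suc g) S
        + ∑[ h ∈ allFin j ] (if lookup S h then 0# else β′ (suc (g ℕ.+ freeBelow h S)) * weightSum i (suc g) (S [ h ]≔ true))
        ≈⟨ +-cong (weightSum≈σ*segment i (suc g) S) (∑-cong (allFin j) matched) ⟩
      σ′ (suc g ℕ.+ i) * segment (suc g) F + ∑[ h ∈ allFin j ] (rankβ (suc g) S h * K)
        ≈⟨ +-congˡ (trans (∑-*ʳ (allFin j) K (rankβ (suc g) S)) (*-congʳ (∑-rankβ (suc g) S))) ⟩
      σ′ (suc g ℕ.+ i) * segment (suc g) F + (t (suc g) - t (suc g ℕ.+ F)) * K
        ≈⟨ factor (σ′ (suc g ℕ.+ i)) _ _ _ ⟩
      σ′ (suc g ℕ.+ i) * (segment (suc g) F + (t (suc g) - t (suc g ℕ.+ F)) * segment (suc g) (ℕ.pred F))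
        ≈⟨ *-congˡ (segment-step g F) ⟩
      σ′ (suc g ℕ.+ i) * segment g F
        ≡⟨ ≡.cong (λ m → σ′ m * segment g F) (ℕₚ.+-suc g i) ⟨
      σ′ (g ℕ.+ suc i) * segment g F
        ∎
      where
      F = free S
      K = σ′ (suc g ℕ.+ i) * segment (suc g) (ℕ.pred F)
      factor : ∀ s a d b → s * a + d * (s * b) ≈ s * (a + d * b)
      factor = solve 4 (λ s a d b → s :* a :+ d :* (s :* b) := s :* (a :+ d :* b)) ≈-refl
      matched : ∀ h → (if lookup S h then 0# else β′ (suc (g ℕ.+ freeBelow h S)) * weightSum i (suc g) (S [ h ]≔ true))
                      ≈ rankβ (suc g) S h * K
      matched h with lookup S h in h-free
      ... | true  = sym (zeroˡ K)
      ... | false = *-congˡ (trans (weightSum≈σ*segment i (suc g) (S [ h ]≔ true))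
          (reflexive (≡.cong (λ m → σ′ (suc g ℕ.+ i) * segment (suc g) (ℕ.pred m)) (≡.sym (free-mark h S h-free)))))

    weightFrom-factor : ∀ {i j} g (S : Vec Bool j) (v : PMap i j) → T (fits S v) →
      weightFrom g S v ≈ prodR R (map β′ (rankWeights g S v)) * σ′ (g ℕ.+ i ℕ.+ free S ℕ.∸ size v)
    weightFrom-factor g S [] _ =
      sym (trans (*-identityˡ _) (reflexive (≡.cong (λ m → σ′ (m ℕ.+ free S)) (ℕₚ.+-identityʳ g))))
    weightFrom-factor {suc i} g S (nothing ∷ v) fit =
      trans (weightFrom-factor (suc g) S v fit)
            (*-congˡ (reflexive (≡.cong (λ m → σ′ (m ℕ.+ free S ℕ.∸ size v)) (≡.sym (ℕₚ.+-suc g i)))))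
    weightFrom-factor {suc i} g S (just h ∷ v) fit with lookup S h in h-free
    ... | false = begin
      β′ w * weightFrom (suc g) S′ v
        ≈⟨ *-congˡ (weightFrom-factor (suc g) S′ v fit) ⟩
      β′ w * (P * σ′ (suc g ℕ.+ i ℕ.+ free S′ ℕ.∸ size v))
        ≈⟨ *-assoc _ _ _ ⟨
      β′ w * P * σ′ (suc g ℕ.+ i ℕ.+ free S′ ℕ.∸ size v)
        ≡⟨ ≡.cong (λ m → β′ w * P * σ′ m) index ⟩
      β′ w * P * σ′ (g ℕ.+ suc i ℕ.+ free S ℕ.∸ suc (size v))
        ∎
      where
      S′ = S [ h ]≔ true
      w  = suc (g ℕ.+ freeBelow h S)
      P  = prodR R (map β′ (rankWeights (suc g) S′ v))
      index : suc g ℕ.+ i ℕ.+ free S′ ℕ.∸ size v ≡ g ℕ.+ suc i ℕ.+ free S ℕ.∸ suc (size v)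
      index rewrite free-mark h S h-free | ℕₚ.+-suc (g ℕ.+ suc i) (free S′) | ℕₚ.+-suc g i = ≡.refl

    weightFrom-wtM : ∀ {i j} (v : PMap i j) → T (fits (replicate j false) v) →
      weightFrom 0 (replicate j false) v ≈ wtM R t v * σ′ (i ℕ.+ j ℕ.∸ size v)
    weightFrom-wtM {i} {j} v fit = trans (weightFrom-factor 0 ∅ v fit)
      (reflexive (≡.cong₂ (λ ws m → prodR R ws * σ′ (i ℕ.+ m ℕ.∸ size v)) (≡.sym weights) (free-replicate j)))
      where
      ∅ = replicate j false
      weights : map (β′ ∘ edgeWeight (edges v)) (edges v) ≡ map β′ (rankWeights 0 ∅ v)
      weights = ≡.trans (map-∘ (edges v))
        (≡.cong (map β′) (edgeWeights≡rankWeights 0 ∅ [] v [] (λ x → ≡.sym (usedBelow-replicate j x)) fit))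

    segment₀≈σ : ∀ u → segment 0 u ≈ σ′ u
    segment₀≈σ u = trans (sym (*-identityˡ _)) (σ*segment 0 u)

    σ*σ≈∑wtM : ∀ i j →
      σ′ i * σ′ j ≈ ∑[ v ∈ allPMaps i j ] (if does (isMatching? v) then wtM R t v * σ′ (i ℕ.+ j ℕ.∸ size v) else 0#)
    σ*σ≈∑wtM i j = begin
      σ′ i * σ′ j
        ≈⟨ *-congˡ (segment₀≈σ j) ⟨
      σ′ i * segment 0 j
        ≡⟨ ≡.cong (λ F → σ′ i * segment 0 F) (free-replicate j) ⟨
      σ′ i * segment 0 (free ∅)
        ≈⟨ weightSum≈σ*segment i 0 ∅ ⟨
      ∑[ v ∈ allPMaps i j ] (if fits ∅ v then weightFrom 0 ∅ v else 0#)
        ≈⟨ ∑-cong (allPMaps i j) pointwise ⟩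
      ∑[ v ∈ allPMaps i j ] (if does (isMatching? v) then wtM R t v * σ′ (i ℕ.+ j ℕ.∸ size v) else 0#)
        ∎
      where
      ∅ = replicate j false
      pointwise : ∀ v → (if fits ∅ v then weightFrom 0 ∅ v else 0#)
                      ≈ (if does (isMatching? v) then wtM R t v * σ′ (i ℕ.+ j ℕ.∸ size v) else 0#)
      pointwise v rewrite isMatching?≡fits v = if-cong (fits ∅ v) (weightFrom-wtM v)

    ∑-δ-σ : ∀ n → σ′ (suc n) ≈ 0# → ∀ {s m} → s ≤ m → ∀ x →
      ∑[ k ∈ upTo (suc n) ] ((if does (s ℕ.+ k ℕ.≟ m) then x else 0#) * σ′ k) ≈ x * σ′ (m ℕ.∸ s)
    ∑-δ-σ n σ₁₊ₙ≈0 {s} {m} s≤m x = begin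
      ∑[ k ∈ upTo (suc n) ] ((if does (s ℕ.+ k ℕ.≟ m) then x else 0#) * σ′ k)
        ≈⟨ ∑-cong (upTo (suc n)) (λ k → trans (if-*ʳ _ (σ′ k) x) (reflexive (≡.cong (if_then x * σ′ k else 0#) (shift k)))) ⟩
      ∑[ k ∈ upTo (suc n) ] (if does (k ℕ.≟ m ℕ.∸ s) then x * σ′ k else 0#)
        ≈⟨ ∑-upTo-δ (suc n) (m ℕ.∸ s) (λ k → x * σ′ k) ⟩
      (if does (m ℕ.∸ s ℕ.<? suc n) then x * σ′ (m ℕ.∸ s) else 0#)
        ≈⟨ in-range (m ℕ.∸ s ℕ.<? suc n) ⟩
      x * σ′ (m ℕ.∸ s)
        ∎
      where
      shift : ∀ k → does (s ℕ.+ k ℕ.≟ m) ≡ does (k ℕ.≟ m ℕ.∸ s)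
      shift k = does-⇔
        (mk⇔ (λ s+k≡m → ≡.trans (≡.sym (ℕₚ.m+n∸m≡n s k)) (≡.cong (ℕ._∸ s) s+k≡m))
             (λ k≡m∸s → ≡.trans (≡.cong (s ℕ.+_) k≡m∸s) (ℕₚ.m+[n∸m]≡n s≤m)))
        (s ℕ.+ k ℕ.≟ m) (k ℕ.≟ m ℕ.∸ s)
      in-range : (d : Dec (m ℕ.∸ s ℕ.< suc n)) → (if does d then x * σ′ (m ℕ.∸ s) else 0#) ≈ x * σ′ (m ℕ.∸ s)
      in-range (yes _)  = ≈-refl
      in-range (no out) = sym (trans (*-congˡ (σ-vanishes n σ₁₊ₙ≈0 (ℕₚ.≮⇒≥ out))) (zeroʳ x))

    ∑-matchingSum-σ : ∀ n → σ′ (suc n) ≈ 0# → ∀ i j →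
      ∑[ k ∈ upTo (suc n) ] (matchingSum R t i j k * σ′ k)
        ≈ ∑[ v ∈ allPMaps i j ] (if does (isMatching? v) then wtM R t v * σ′ (i ℕ.+ j ℕ.∸ size v) else 0#)
    ∑-matchingSum-σ n σ₁₊ₙ≈0 i j = begin
      ∑[ k ∈ ks ] (matchingSum R t i j k * σ′ k)
        ≈⟨ ∑-cong ks (λ k → *-congʳ (trans (∑-filter _ (matchings i j) (wtM R t)) (∑-filter isMatching? L _))) ⟩
      ∑[ k ∈ ks ] (∑[ v ∈ L ] term k v * σ′ k)
        ≈⟨ ∑-cong ks (λ k → ∑-*ʳ L (σ′ k) (term k)) ⟨
      ∑[ k ∈ ks ] ∑[ v ∈ L ] (term k v * σ′ k)
        ≈⟨ ∑-comm ks L _ ⟩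
      ∑[ v ∈ L ] ∑[ k ∈ ks ] (term k v * σ′ k)
        ≈⟨ ∑-cong L collapse ⟩
      ∑[ v ∈ L ] (if does (isMatching? v) then wtM R t v * σ′ (i ℕ.+ j ℕ.∸ size v) else 0#)
        ∎
      where
      ks = upTo (suc n)
      L  = allPMaps i j
      term : ℕ → PMap i j → Carrier
      term k v = if does (isMatching? v) then (if does (size v ℕ.+ k ℕ.≟ i ℕ.+ j) then wtM R t v else 0#) else 0#
      collapse : ∀ v → ∑[ k ∈ ks ] (term k v * σ′ k)
                     ≈ (if does (isMatching? v) then wtM R t v * σ′ (i ℕ.+ j ℕ.∸ size v) else 0#)
      collapse v with does (isMatching? v)
      ... | true  = ∑-δ-σ n σ₁₊ₙ≈0 (ℕₚ.m≤n⇒m≤n+o j (size≤ v)) (wtM R t v)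
      ... | false = ∑-zero ks (λ k → zeroˡ (σ′ k))

theorem1p2 : ∀ {c ℓ} (R : CommutativeRing c ℓ) (n : ℕ) → 1 ≤ n →
    (i j : ℕ) → i ≤ n → j ≤ n →
    (t : ℕ → CommutativeRing.Carrier R) (ζ : CommutativeRing.Carrier R) →
    CommutativeRing._≈_ R (σ R t ζ (suc n)) (CommutativeRing.0# R) →
    CommutativeRing._≈_ R
    (CommutativeRing._*_ R (σ R t ζ i) (σ R t ζ j))
    (sumR R (map (λ k → CommutativeRing._*_ R (matchingSum R t i j k) (σ R t ζ k)) (upTo (suc n))))
theorem1p2 R n _ i j _ _ t ζ σ₁₊ₙ≈0 = trans (σ*σ≈∑wtM R t ζ i j) (sym (∑-matchingSum-σ R t ζ n σ₁₊ₙ≈0 i j))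
  where open CommutativeRing R using (trans; sym)
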